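{- Let $p$ be an odd prime and let $x \in \mathbb{Z}_p$. If $j$ is an integer with $0 \leq j \leq p$, then \[ \Gamma_p(x+j)\equiv \left(\operatorname{rep}(x)+j-1\right)!\,(-1)^{\operatorname{rep}(x)+j} \cdot \delta \pmod{p}, \] where $\delta=1$ if $0\leq j\leq p- \operatorname{rep}(x)$ and $\delta=\frac{1}{p}$ if $p- \operatorname{rep}(x)+1\leq j\leq p$.
   Context: $\Gamma_p$ is Morita's $p$-adic gamma function. For $x\in\mathbb{Z}_p$, $\operatorname{rep}(x)$ is the unique element of $\{1,2,\dots,p\}$ congruent to $x$ modulo $p$. -}

module Defs where

open import Data.Nat using (ℕ; zero; suc; _+_; _*_; _^_; _/_; NonZero)
open import Data.Nat.Properties using (m^n≢0)
open import Data.Nat.DivMod using (_mod_)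
open import Data.Nat.Divisibility using (_∣?_)
open import Data.Fin using (Fin; toℕ)
open import Data.Integer as ℤ using (ℤ; +_; -[1+_])
open import Data.Integer.DivMod using (_%ℕ_)
open import Relation.Nullary using (yes; no)

-- p-adic integers, represented by their (unique) base-p digit expansion
--   x = Σ_k digit x k * p^k .
record ℤₚ (p : ℕ) : Set where
  constructor mkℤₚ
  field digit : ℕ → Fin p
open ℤₚ public

-- x mod p^k, as the representative in [0, p^k)
trunc : ∀ {p} → ℤₚ p → ℕ → ℕ
trunc x zero = 0
trunc {p} x (suc k) = trunc x k + toℕ (digit x k) * p ^ k

-- the p-adic integer whose residue mod p^(k+1) is f (k+1) mod p^(k+1)
-- (f must be a coherent system of residues for this to be meaningful)
fromResidues : (p : ℕ) .{{_ : NonZero p}} → (ℕ → ℕ) → ℤₚ p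
fromResidues p f = mkℤₚ λ k → ((f (suc k) / p ^ k) {{m^n≢0 p k}}) mod p

ι : (p : ℕ) .{{_ : NonZero p}} → ℕ → ℤₚ p
ι p n = fromResidues p (λ _ → n)

plus : (p : ℕ) .{{_ : NonZero p}} → ℤₚ p → ℤₚ p → ℤₚ p
plus p x y = fromResidues p (λ k → trunc x k + trunc y k)

unitProd : ℕ → ℕ → ℕ
unitProd p zero = 1
unitProd p (suc k) with p ∣? k
... | yes _ = unitProd p k
... | no  _ = unitProd p k * k

Γnat : ℕ → ℕ → ℤ
Γnat p n = (-[1+ 0 ] ℤ.^ n) ℤ.* (+ unitProd p n)

-- Morita's p-adic gamma function on ℤₚ, defined by continuity:
--   Γ_p(x) ≡ Γ_p(x mod p^k)  (mod p^k)  for every k.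
Γₚ : (p : ℕ) .{{_ : NonZero p}} → ℤₚ p → ℤₚ p
Γₚ p x = fromResidues p (λ k → (Γnat p (trunc x k) %ℕ (p ^ k)) {{m^n≢0 p k}})

rep : ∀ {p} → ℤₚ p → ℕ
rep {p} x with toℕ (digit x 0)
... | zero  = p
... | suc r = suc r

module Submission where

-- Γ_p(x + j) modulo p only sees the first digit of x + j, which is the residue
-- s mod p of s = rep(x) + j ∈ [1, 2p].  So the theorem reduces to evaluating the
-- natural-number gamma function Γ(n) = (-1)^n ∏_{0<k<n, p∤k} k at residues:
--   * for 1 ≤ s ≤ p−1 the product is (s−1)!, giving the first case;
--   * for s = p the residue is 0 and Γ(0) = 1 ≡ (p−1)! (−1)^p by Wilson's theorem;
--   * for s = p + m with 1 ≤ m ≤ p the residue is m, and ⌊(s−1)!/p⌋ ≡ (p−1)!(m−1)!,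
--     so Wilson's theorem again turns the right-hand side into (m−1)!(−1)^m.

open import Defs
open import Data.Nat using (ℕ; zero; suc; _+_; _∸_; _≤_; _<_; _/_; _%_; _>_; _!; NonZero; z≤n; s≤s; >-nonZero⁻¹; nonTrivial⇒n>1) renaming (_*_ to _*ℕ_; _^_ to _^ℕ_)
open import Data.Product using (_×_; Σ; _,_; proj₁; proj₂)
open import Data.Nat.Primality using (Prime; prime⇒nonZero; prime⇒nonTrivial; prime⇒irreducible; euclidsLemma)
open import Data.Fin using (toℕ)
open import Data.Integer using (ℤ; +_; -[1+_]; _-_; _*_; _^_; -1ℤ; _%ℕ_; _/ℕ_; ∣_∣; -_) renaming (_+_ to _+ℤ_)
open import Data.Integer.Divisibility using (_∣_)
open import Relation.Binary.PropositionalEquality using (_≢_; _≡_; refl; sym; trans; cong; cong₂; subst; module ≡-Reasoning)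
open import Function using (_∘_)
open import Data.Sum using (_⊎_; inj₁; inj₂; [_,_]′)
open import Data.Empty using (⊥-elim)
open import Relation.Nullary using (yes; no)
open import Relation.Binary.Bundles using (Setoid)
import Relation.Binary.Reasoning.Setoid as SetoidReasoning
import Data.Nat.Properties as ℕᵖ
import Data.Integer.Properties as ℤᵖ
open import Data.Nat.Divisibility as ℕ∣ using (divides; ∣⇒≤; _∣?_)
open import Data.Nat.DivMod using (m≡m%n+[m/n]*n; m%n<n; n/1≡n; m*n/n≡m; %-distribˡ-+; m%n%n≡m%n; [m+n]%n≡m%n; n%n≡0; m<n⇒m%n≡m)
open import Data.Nat.Coprimality using (prime⇒coprime; coprime-Bézout)
open import Data.Nat.GCD using (module Bézout)
open import Data.Integer.DivMod using (a≡a%ℕn+[a/ℕn]*n; n%ℕd<d)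
open import Data.Fin.Properties using (toℕ-fromℕ<; toℕ<n)
open import Data.List using (List; []; _∷_; _++_; length)
open import Data.Nat.ListAction using (product)
open import Data.Nat.ListAction.Properties using (product-↭)
open import Data.List.Membership.Propositional using (_∈_)
open import Data.List.Membership.Propositional.Properties using (∈-∃++)
open import Data.List.Relation.Unary.Any using (here; there)
import Data.List.Relation.Unary.All as All
open import Data.List.Relation.Unary.AllPairs using ([]; _∷_)
open import Data.List.Relation.Unary.Unique.Propositional using (Unique)
open import Data.List.Relation.Binary.Permutation.Propositional using (_↭_; ↭-sym; ↭⇒↭ₛ)
open import Data.List.Relation.Binary.Permutation.Propositional.Properties using (shift; ∈-resp-↭; ↭-length)
open import Relation.Binary.PropositionalEquality.Properties using (setoid)
open import Data.List.Relation.Binary.Permutation.Setoid.Properties (setoid ℕ) using (Unique-resp-↭)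
open import Data.Integer.Tactic.RingSolver using (solve-∀)
import Data.Nat.Tactic.RingSolver as ℕSolver

infix 4 _≡_mod_

record _≡_mod_ (a b : ℤ) (n : ℕ) : Set where
  constructor by
  field
    quotient : ℤ
    equation : a ≡ b +ℤ quotient * + n

pos-+* : ∀ u v w → + (u + v *ℕ w) ≡ + u +ℤ + v * + w
pos-+* u v w = trans (ℤᵖ.pos-+ u (v *ℕ w)) (cong (+ u +ℤ_) (ℤᵖ.pos-* v w))

module _ {n : ℕ} where

  mod-refl : ∀ {a} → a ≡ a mod n
  mod-refl {a} = by (+ 0) (identity a (+ n))
    where identity : ∀ a n → a ≡ a +ℤ + 0 * n
          identity = solve-∀

  ≡⇒mod : ∀ {a b} → a ≡ b → a ≡ b mod n
  ≡⇒mod refl = mod-refl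

  mod-sym : ∀ {a b} → a ≡ b mod n → b ≡ a mod n
  mod-sym {b = b} (by q refl) = by (- q) (identity b q (+ n))
    where identity : ∀ b q n → b ≡ (b +ℤ q * n) +ℤ - q * n
          identity = solve-∀

  mod-trans : ∀ {a b c} → a ≡ b mod n → b ≡ c mod n → a ≡ c mod n
  mod-trans {c = c} (by q refl) (by r refl) = by (r +ℤ q) (identity c q r (+ n))
    where identity : ∀ c q r n → (c +ℤ r * n) +ℤ q * n ≡ c +ℤ (r +ℤ q) * n
          identity = solve-∀

  mod-* : ∀ {a b c d} → a ≡ b mod n → c ≡ d mod n → a * c ≡ b * d mod n
  mod-* {b = b} {d = d} (by q refl) (by r refl) =
    by (q * d +ℤ b * r +ℤ q * r * + n) (identity b d q r (+ n))
    where identity : ∀ b d q r n → (b +ℤ q * n) * (d +ℤ r * n)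
                                   ≡ b * d +ℤ (q * d +ℤ b * r +ℤ q * r * n) * n
          identity = solve-∀

  mod-*ˡ : ∀ k {a b} → a ≡ b mod n → k * a ≡ k * b mod n
  mod-*ˡ k = mod-* (mod-refl {a = k})

  mod-*ʳ : ∀ k {a b} → a ≡ b mod n → a * k ≡ b * k mod n
  mod-*ʳ k a≡b = mod-* a≡b (mod-refl {a = k})

  mod⇒∣ : ∀ {a b} → a ≡ b mod n → + n ∣ a - b
  mod⇒∣ {b = b} (by q refl) =
    divides ∣ q ∣ (trans (cong ∣_∣ (identity b q (+ n))) (ℤᵖ.abs-* q (+ n)))
    where identity : ∀ b q n → (b +ℤ q * n) - b ≡ q * n
          identity = solve-∀

  remainder : .{{_ : NonZero n}} → ∀ z → z ≡ + (z %ℕ n) mod n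
  remainder z = by (z /ℕ n) (a≡a%ℕn+[a/ℕn]*n z n)

  mod⇒∣ℕ : ∀ {k m} → + (k + m) ≡ + k mod n → n ℕ∣.∣ m
  mod⇒∣ℕ {k} {m} k+m≡k = subst (n ℕ∣.∣_) (cong ∣_∣ difference) (mod⇒∣ k+m≡k)
    where
    identity : ∀ k m → (k +ℤ m) - k ≡ m
    identity = solve-∀
    difference : + (k + m) - + k ≡ + m
    difference = trans (cong (_- + k) (ℤᵖ.pos-+ k m)) (identity (+ k) (+ m))

  ≥-modulus : ∀ {u v} q → + u ≡ + v +ℤ + suc q * + n → n ≤ u
  ≥-modulus {u} {v} q eq = subst (n ≤_) (sym (ℤᵖ.+-injective (trans eq (sym (pos-+* v (suc q) n)))))
    (ℕᵖ.≤-trans (ℕᵖ.m≤m+n n (q *ℕ n)) (ℕᵖ.m≤n+m (suc q *ℕ n) v))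

  -- two naturals below n that are congruent modulo n are equal: a nonzero
  -- quotient would make one of them at least n
  mod-unique : ∀ {a c} → a < n → c < n → + a ≡ + c mod n → a ≡ c
  mod-unique {c = c} _ _ (by (+ 0) eq) = ℤᵖ.+-injective (trans eq (identity (+ c) (+ n)))
    where identity : ∀ c n → c +ℤ + 0 * n ≡ c
          identity = solve-∀
  mod-unique a<n _ (by (+ suc q) eq) = ⊥-elim (ℕᵖ.<⇒≱ a<n (≥-modulus q eq))
  mod-unique {a} {c} _ c<n (by -[1+ q ] eq) =
    ⊥-elim (ℕᵖ.<⇒≱ c<n (≥-modulus q (trans (identity (+ c) (+ suc q) (+ n)) (cong (_+ℤ + suc q * + n) (sym eq)))))
    where identity : ∀ c k n → c ≡ (c +ℤ - k * n) +ℤ k * n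
          identity = solve-∀

mod-setoid : ℕ → Setoid _ _
mod-setoid n = record
  { Carrier       = ℤ
  ; _≈_           = λ a b → a ≡ b mod n
  ; isEquivalence = record { refl = mod-refl ; sym = mod-sym ; trans = mod-trans }
  }

module mod-Reasoning (n : ℕ) = SetoidReasoning (mod-setoid n)

inverse-unique : ∀ {n a b c} → a < n → c < n →
                 + a * + b ≡ + 1 mod n → + c * + b ≡ + 1 mod n → a ≡ c
inverse-unique {n} {a} {b} {c} a<n c<n ab≡1 cb≡1 = mod-unique a<n c<n (begin
  + a                  ≡⟨ ℤᵖ.*-identityʳ (+ a) ⟨
  + a * + 1            ≈⟨ mod-*ˡ (+ a) (mod-sym cb≡1) ⟩
  + a * (+ c * + b)    ≡⟨ swap (+ a) (+ c) (+ b) ⟩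
  + c * (+ a * + b)    ≈⟨ mod-*ˡ (+ c) ab≡1 ⟩
  + c * + 1            ≡⟨ ℤᵖ.*-identityʳ (+ c) ⟩
  + c                  ∎)
  where
  open mod-Reasoning n
  swap : ∀ a c b → a * (c * b) ≡ c * (a * b)
  swap = solve-∀

module _ {p : ℕ} (p-prime : Prime p) where

  private instance
    p≢0 : NonZero p
    p≢0 = prime⇒nonZero p-prime

  1<p : 1 < p
  1<p = nonTrivial⇒n>1 p {{prime⇒nonTrivial p-prime}}

  -- a residue 0 < a < p has an inverse below p: Bézout for the coprime pair p, a
  inverse-exists : ∀ {a} → 0 < a → a < p → Σ ℕ λ b → b < p × (+ a * + b ≡ + 1 mod p)
  inverse-exists {suc a} _ a<p = reduce (from-bézout (coprime-Bézout (prime⇒coprime p-prime a<p)))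
    where
    reduce : Σ ℤ (λ z → + suc a * z ≡ + 1 mod p) → Σ ℕ λ b → b < p × (+ suc a * + b ≡ + 1 mod p)
    reduce (z , az≡1) = z %ℕ p , n%ℕd<d z p , mod-trans (mod-*ˡ (+ suc a) (mod-sym (remainder z))) az≡1
    from-bézout : Bézout.Identity 1 p (suc a) → Σ ℤ λ z → + suc a * z ≡ + 1 mod p
    from-bézout (Bézout.+- x y eq) = - + y , by (- + x) (begin
      + suc a * - + y                 ≡⟨ expand (+ suc a) (+ y) ⟩
      + 1 +ℤ - (+ 1 +ℤ + y * + suc a) ≡⟨ cong (λ t → + 1 +ℤ - t) (trans (sym (pos-+* 1 y (suc a))) (trans (cong +_ eq) (ℤᵖ.pos-* x p))) ⟩
      + 1 +ℤ - (+ x * + p)            ≡⟨ cong (+ 1 +ℤ_) (ℤᵖ.neg-distribˡ-* (+ x) (+ p)) ⟩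
      + 1 +ℤ - + x * + p              ∎)
      where
      open ≡-Reasoning
      expand : ∀ a y → a * - y ≡ + 1 +ℤ - (+ 1 +ℤ y * a)
      expand = solve-∀
    from-bézout (Bézout.-+ x y eq) = + y , by (+ x) (begin
      + suc a * + y      ≡⟨ ℤᵖ.*-comm (+ suc a) (+ y) ⟩
      + y * + suc a      ≡⟨ ℤᵖ.pos-* y (suc a) ⟨
      + (y *ℕ suc a)     ≡⟨ cong +_ eq ⟨
      + (1 + x *ℕ p)     ≡⟨ pos-+* 1 x p ⟩
      + 1 +ℤ + x * + p   ∎)
      where open ≡-Reasoning

  -- the only residues below p that are their own inverse are 1 and p − 1,
  -- since p ∣ a² − 1 = (a − 1)(a + 1)
  self-inverse : ∀ {a} → a < p → + a * + a ≡ + 1 mod p → a ≡ 1 ⊎ suc a ≡ p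
  self-inverse {zero} _ 0≡1 = ⊥-elim (ℕᵖ.0≢1+n (mod-unique (ℕᵖ.<-trans (s≤s z≤n) 1<p) 1<p 0≡1))
  self-inverse {suc a} a<p a²≡1 with euclidsLemma a (suc (suc a)) p-prime (mod⇒∣ℕ a²≡1+[a²−1])
    where
    square : ∀ a → suc a *ℕ suc a ≡ 1 + a *ℕ suc (suc a)
    square = ℕSolver.solve-∀
    a²≡1+[a²−1] : + (1 + a *ℕ suc (suc a)) ≡ + 1 mod p
    a²≡1+[a²−1] = subst (λ t → + t ≡ + 1 mod p) (square a) (mod-trans (≡⇒mod (ℤᵖ.pos-* (suc a) (suc a))) a²≡1)
  ... | inj₁ p∣a = inj₁ (cong suc (divisor-below a (ℕᵖ.<-trans (ℕᵖ.n<1+n a) a<p) p∣a))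
    where
    divisor-below : ∀ a → a < p → p ℕ∣.∣ a → a ≡ 0
    divisor-below zero _ _ = refl
    divisor-below (suc a) a<p p∣a = ⊥-elim (ℕ∣.>⇒∤ a<p p∣a)
  ... | inj₂ p∣a+2 = inj₂ (ℕᵖ.≤-antisym a<p (∣⇒≤ p∣a+2))

Paired : ℕ → List ℕ → Set
Paired p L = ∀ {a} → a ∈ L → Σ ℕ λ b → b ∈ L × b ≢ a × (+ a * + b ≡ + 1 mod p)

extract : ∀ {x : ℕ} {xs} → x ∈ xs → Σ (List ℕ) λ ys → xs ↭ x ∷ ys
extract x∈xs with ys , zs , refl ← ∈-∃++ x∈xs = ys ++ zs , shift _ ys zs

-- a duplicate-free list of residues below p, paired off by inversion, has
-- product ≡ 1: remove the head a together with its partner b and recurse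
product-paired : ∀ {p} L → Unique L → (∀ {a} → a ∈ L → a < p) → Paired p L →
                 + product L ≡ + 1 mod p
product-paired {p} L = go (length L) L ℕᵖ.≤-refl
  where
  -- recursion on a bound for the length, which drops by two in each step
  go : ∀ fuel L → length L ≤ fuel → Unique L → (∀ {a} → a ∈ L → a < p) → Paired p L →
       + product L ≡ + 1 mod p
  go _ [] _ _ _ _ = mod-refl
  go (suc fuel) (a ∷ t) (s≤s |t|≤fuel) (a∉t ∷ t-unique) small paired with paired (here refl)
  ... | b , here refl , b≢a , _ = ⊥-elim (b≢a refl)
  ... | b , there b∈t , _ , ab≡1 with t' , t↭b∷t' ← extract b∈t
    with b∉t' ∷ t'-unique ← Unique-resp-↭ (↭⇒↭ₛ t↭b∷t') t-unique =
    mod-trans (≡⇒mod regroup) (mod-* ab≡1 (go fuel t' |t'|≤fuel t'-unique (small ∘ there ∘ in-t) paired'))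
    where
    in-t : ∀ {c} → c ∈ t' → c ∈ t
    in-t c∈t' = ∈-resp-↭ (↭-sym t↭b∷t') (there c∈t')
    |t'|≤fuel : length t' ≤ fuel
    |t'|≤fuel = ℕᵖ.≤-trans (ℕᵖ.n≤1+n _) (subst (_≤ fuel) (↭-length t↭b∷t') |t|≤fuel)
    regroup : + product (a ∷ t) ≡ + a * + b * + product t'
    regroup = begin
      + (a *ℕ product t)             ≡⟨ cong (λ m → + (a *ℕ m)) (product-↭ t↭b∷t') ⟩
      + (a *ℕ (b *ℕ product t'))     ≡⟨ cong +_ (ℕᵖ.*-assoc a b (product t')) ⟨
      + (a *ℕ b *ℕ product t')       ≡⟨ ℤᵖ.pos-* (a *ℕ b) (product t') ⟩
      + (a *ℕ b) * + product t'      ≡⟨ cong (_* + product t') (ℤᵖ.pos-* a b) ⟩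
      + a * + b * + product t'       ∎
      where open ≡-Reasoning
    -- the partner d of c ∈ t' is neither a nor b, by uniqueness of inverses
    paired' : Paired p t'
    paired' {c} c∈t' with paired (there (in-t c∈t'))
    ... | d , here refl , d≢c , cd≡1 =
      ⊥-elim (All.lookup b∉t' c∈t' (inverse-unique (small (there b∈t)) (small (there (in-t c∈t')))
                                      (mod-trans (≡⇒mod (ℤᵖ.*-comm (+ b) (+ a))) ab≡1) cd≡1))
    ... | d , there d∈t , d≢c , cd≡1 with ∈-resp-↭ t↭b∷t' d∈t
    ...   | there d∈t' = d , d∈t' , d≢c , cd≡1
    ...   | here refl = ⊥-elim (All.lookup a∉t (in-t c∈t')
                          (inverse-unique (small (here refl)) (small (there (in-t c∈t'))) ab≡1 cd≡1))

interval : ℕ → ℕ → List ℕ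
interval k zero    = []
interval k (suc n) = k + suc n ∷ interval k n

∈-interval⁻ : ∀ {k c} n → c ∈ interval k n → k < c × c ≤ k + n
∈-interval⁻ {k} (suc n) (here refl) = ℕᵖ.m<m+n k (s≤s z≤n) , ℕᵖ.≤-refl
∈-interval⁻ {k} (suc n) (there c∈) with k<c , c≤k+n ← ∈-interval⁻ n c∈ =
  k<c , ℕᵖ.≤-trans c≤k+n (ℕᵖ.+-monoʳ-≤ k (ℕᵖ.n≤1+n n))

∈-interval⁺ : ∀ {k c} n → k < c → c ≤ k + n → c ∈ interval k n
∈-interval⁺ {k} zero k<c c≤k+0 = ⊥-elim (ℕᵖ.<⇒≱ k<c (subst (_ ≤_) (ℕᵖ.+-identityʳ k) c≤k+0))
∈-interval⁺ {k} {c} (suc n) k<c c≤ with c ℕᵖ.≟ k + suc n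
... | yes refl = here refl
... | no c≢top = there (∈-interval⁺ n k<c (ℕᵖ.≤-pred (subst (suc c ≤_) (ℕᵖ.+-suc k n) (ℕᵖ.≤∧≢⇒< c≤ c≢top))))

interval-unique : ∀ k n → Unique (interval k n)
interval-unique k zero    = []
interval-unique k (suc n) = All.tabulate top-new ∷ interval-unique k n
  where
  top-new : ∀ {c} → c ∈ interval k n → k + suc n ≢ c
  top-new c∈ refl = ℕᵖ.<⇒≱ (ℕᵖ.+-monoʳ-< k (ℕᵖ.n<1+n n)) (proj₂ (∈-interval⁻ n c∈))

product-interval : ∀ n → product (interval 1 n) ≡ suc n !
product-interval zero    = refl
product-interval (suc n) = cong (suc (suc n) *ℕ_) (product-interval n)

-- b ≡ −1 is its own inverse modulo b + 1
minus-one-self-inverse : ∀ b → + b * + b ≡ + 1 mod suc b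
minus-one-self-inverse b = by (+ b - + 1) (identity (+ b))
  where identity : ∀ b → b * b ≡ + 1 +ℤ (b - + 1) * (+ 1 +ℤ b)
        identity = solve-∀

-- 2, …, p − 2 lie below p = n + 3
interval-below : ∀ n {c} → c ∈ interval 1 n → c < 3 + n
interval-below n c∈ = s≤s (ℕᵖ.≤-trans (proj₂ (∈-interval⁻ n c∈)) (ℕᵖ.n≤1+n _))

-- modulo a prime p = n + 3 the residues 2, …, p − 2 are paired off by inversion:
-- the inverse b of such a c is neither 0, 1 nor p − 1, and b ≠ c
interval-paired : ∀ n → Prime (3 + n) → Paired (3 + n) (interval 1 n)
interval-paired n pp {c} c∈ with 1<c , c≤1+n ← ∈-interval⁻ n c∈
                          with b , b<p , cb≡1 ← inverse-exists pp (ℕᵖ.<-trans (s≤s z≤n) 1<c) (interval-below n c∈) =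
  b , ∈-interval⁺ n (proj₁ (in-range b b<p cb≡1)) (proj₂ (in-range b b<p cb≡1)) , b≢c , cb≡1
  where
  -- b ≠ 0 (else 0 ≡ 1), b ≠ 1 (else c ≡ 1) and b ≠ p − 1 (else c ≡ p − 1)
  in-range : ∀ b → b < 3 + n → + c * + b ≡ + 1 mod 3 + n → 1 < b × b ≤ 1 + n
  in-range zero _ c0≡1 = ⊥-elim (ℕᵖ.0≢1+n (mod-unique (s≤s z≤n) (1<p pp)
                           (mod-trans (≡⇒mod (sym (ℤᵖ.*-zeroʳ (+ c)))) c0≡1)))
  in-range (suc zero) _ c1≡1 =
    ⊥-elim (ℕᵖ.<⇒≢ 1<c (sym (inverse-unique (interval-below n c∈) (1<p pp) c1≡1 mod-refl)))
  in-range (suc (suc b)) b<p cb≡1 with suc (suc b) ℕᵖ.≟ suc (suc n)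
  ... | yes refl = ⊥-elim (ℕᵖ.<⇒≱ (s≤s c≤1+n)
                     (ℕᵖ.≤-reflexive (inverse-unique b<p (interval-below n c∈) (minus-one-self-inverse _) cb≡1)))
  ... | no b≢p-1 = s≤s (s≤s z≤n) , ℕᵖ.≤-pred (ℕᵖ.≤∧≢⇒< (ℕᵖ.≤-pred b<p) b≢p-1)
  -- c is not its own inverse, since 1 < c < p − 1
  b≢c : b ≢ c
  b≢c refl with self-inverse pp (interval-below n c∈) cb≡1
  ... | inj₁ c≡1   = ℕᵖ.<⇒≢ 1<c (sym c≡1)
  ... | inj₂ c+1≡p = ℕᵖ.<⇒≱ (s≤s (s≤s c≤1+n)) (ℕᵖ.≤-reflexive (sym c+1≡p))

-- Wilson's theorem: (p − 1)! ≡ −1 (mod p) for every prime p.  For p ≥ 3 the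
-- product of 2, …, p − 2 is ≡ 1 by pairing, leaving p − 1 ≡ −1
wilson : ∀ {p} → Prime p → + ((p ∸ 1) !) ≡ -1ℤ mod p
wilson pp = by-size _ pp (1<p pp)
  where
  by-size : ∀ p → Prime p → 1 < p → + ((p ∸ 1) !) ≡ -1ℤ mod p
  by-size (suc (suc zero)) _ _ = by (+ 1) refl
  by-size (suc (suc (suc n))) pp _ = begin
    + (suc (suc n) !)                          ≡⟨ ℤᵖ.pos-* (suc (suc n)) (suc n !) ⟩
    + suc (suc n) * + (suc n !)                ≡⟨ cong (λ m → + suc (suc n) * + m) (product-interval n) ⟨
    + suc (suc n) * + product (interval 1 n)   ≈⟨ mod-* p-1≡-1
                                                        (product-paired _ (interval-unique 1 n) (interval-below n) (interval-paired n pp)) ⟩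
    -1ℤ * + 1                                  ≡⟨⟩
    -1ℤ                                        ∎
    where
    open mod-Reasoning (3 + n)
    p-1≡-1 : + suc (suc n) ≡ -1ℤ mod 3 + n
    p-1≡-1 = by (+ 1) (identity (+ suc (suc n)))
      where identity : ∀ m → m ≡ -1ℤ +ℤ + 1 * (+ 1 +ℤ m)
            identity = solve-∀

odd-prime : ∀ {p} → Prime p → p ≢ 2 → Σ ℕ λ h → p ≡ suc (2 *ℕ h)
odd-prime {p} pp p≢2 with p % 2 | m≡m%n+[m/n]*n p 2 | m%n<n p 2
... | zero        | p≡[p/2]*2   | _ = ⊥-elim ([ (λ ()) , (λ 2≡p → p≢2 (sym 2≡p)) ]′
                                      (prime⇒irreducible pp (divides (p / 2) p≡[p/2]*2)))
... | suc zero    | p≡1+[p/2]*2 | _ = p / 2 , trans p≡1+[p/2]*2 (cong suc (ℕᵖ.*-comm (p / 2) 2))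
... | suc (suc _) | _           | s≤s (s≤s ())

neg-one-odd-power : ∀ h → -1ℤ ^ suc (2 *ℕ h) ≡ -1ℤ
neg-one-odd-power h = cong (-1ℤ *_) (trans (sym (ℤᵖ.^-*-assoc -1ℤ 2 h)) (ℤᵖ.^-zeroˡ h))

-- Wilson's theorem with its sign: (p − 1)! (−1)^p ≡ 1 (mod p) for every prime
-- p; for odd p both factors are ≡ −1, and for p = 2 both are ≡ 1
wilson-signed : ∀ {p} → Prime p → + ((p ∸ 1) !) * -1ℤ ^ p ≡ + 1 mod p
wilson-signed {p} pp with p ℕᵖ.≟ 2
... | yes refl = mod-refl
... | no p≢2 with h , p≡1+2h ← odd-prime pp p≢2 = begin
  + ((p ∸ 1) !) * -1ℤ ^ p   ≡⟨ cong (λ e → + ((p ∸ 1) !) * -1ℤ ^ e) p≡1+2h ⟩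
  + ((p ∸ 1) !) * -1ℤ ^ suc (2 *ℕ h)   ≡⟨ cong (+ ((p ∸ 1) !) *_) (neg-one-odd-power h) ⟩
  + ((p ∸ 1) !) * -1ℤ   ≈⟨ mod-*ʳ -1ℤ (wilson pp) ⟩
  -1ℤ * -1ℤ             ≡⟨⟩
  + 1                   ∎
  where open mod-Reasoning p

-- (p+k)! = p · (p−1)! · Q with Q ≡ k! (mod p): the factors p+1, …, p+k are
-- congruent to 1, …, k
factorial-beyond : ∀ q k → Σ ℕ λ Q → (suc q + k) ! ≡ suc q *ℕ (q ! *ℕ Q) × (+ Q ≡ + (k !) mod suc q)
factorial-beyond q zero =
  1 , trans (cong _! (ℕᵖ.+-identityʳ (suc q))) (cong (suc q *ℕ_) (sym (ℕᵖ.*-identityʳ (q !)))) , mod-refl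
factorial-beyond q (suc k) with Q , fact , Q≡k! ← factorial-beyond q k =
  next *ℕ Q , fact′ , next*Q≡suc-k!
  where
  next : ℕ
  next = suc (suc q + k)
  next≡suc-k : + next ≡ + suc k mod suc q
  next≡suc-k = by (+ 1) (trans (cong +_ (expand q k)) (pos-+* (suc k) 1 (suc q)))
    where expand : ∀ q k → suc (suc q + k) ≡ suc k + 1 *ℕ suc q
          expand = ℕSolver.solve-∀
  fact′ : (suc q + suc k) ! ≡ suc q *ℕ (q ! *ℕ (next *ℕ Q))
  fact′ = trans (cong _! (ℕᵖ.+-suc (suc q) k))
                (trans (cong (next *ℕ_) fact) (reorder next (suc q) (q !) Q))
    where reorder : ∀ a b c d → a *ℕ (b *ℕ (c *ℕ d)) ≡ b *ℕ (c *ℕ (a *ℕ d))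
          reorder = ℕSolver.solve-∀
  next*Q≡suc-k! : + (next *ℕ Q) ≡ + (suc k !) mod suc q
  next*Q≡suc-k! = begin
    + (next *ℕ Q)       ≡⟨ ℤᵖ.pos-* next Q ⟩
    + next * + Q        ≈⟨ mod-* next≡suc-k Q≡k! ⟩
    + suc k * + (k !)   ≡⟨ ℤᵖ.pos-* (suc k) (k !) ⟨
    + (suc k !)         ∎
    where open mod-Reasoning (suc q)

quotient-factorial : ∀ p .{{_ : NonZero p}} k → + ((p + k) ! / p) ≡ + ((p ∸ 1) !) * + (k !) mod p
quotient-factorial (suc q) k with Q , fact , Q≡k! ← factorial-beyond q k = begin
  + ((suc q + k) ! / suc q)          ≡⟨ cong (λ m → + (m / suc q)) fact ⟩
  + (suc q *ℕ (q ! *ℕ Q) / suc q)    ≡⟨ cong (λ m → + (m / suc q)) (ℕᵖ.*-comm (suc q) (q ! *ℕ Q)) ⟩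
  + (q ! *ℕ Q *ℕ suc q / suc q)      ≡⟨ cong +_ (m*n/n≡m (q ! *ℕ Q) (suc q)) ⟩
  + (q ! *ℕ Q)                        ≡⟨ ℤᵖ.pos-* (q !) Q ⟩
  + (q !) * + Q                       ≈⟨ mod-*ˡ (+ (q !)) Q≡k! ⟩
  + (q !) * + (k !)                   ∎
  where open mod-Reasoning (suc q)

-- among 0, …, n < p only 0 is divisible by p, so the unit product is n!
unitProd-below : ∀ {p n} → n < p → unitProd p (suc n) ≡ n !
unitProd-below {p} {zero} _ with p ∣? 0
... | yes _   = refl
... | no p∤0 = ⊥-elim (p∤0 (p ℕ∣.∣0))
unitProd-below {p} {suc n} n<p with p ∣? suc n
... | yes p∣n = ⊥-elim (ℕ∣.>⇒∤ n<p p∣n)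
... | no _    = trans (cong (_*ℕ suc n) (unitProd-below (ℕᵖ.<-trans (ℕᵖ.n<1+n n) n<p))) (ℕᵖ.*-comm (n !) (suc n))

module _ {p : ℕ} (p-prime : Prime p) where

  private instance
    p≢0 : NonZero p
    p≢0 = prime⇒nonZero p-prime

  -- Γ(n mod p) ≡ (n−1)! (−1)^n for 1 ≤ n ≤ p; at n = p this is Wilson's theorem
  Γnat-residue : ∀ {n} → 0 < n → n ≤ p → Γnat p (n % p) ≡ + ((n ∸ 1) !) * -1ℤ ^ n mod p
  Γnat-residue {suc m} _ n≤p with ℕᵖ.m≤n⇒m<n∨m≡n n≤p
  ... | inj₁ n<p = ≡⇒mod (begin
    Γnat p (suc m % p)                   ≡⟨ cong (Γnat p) (m<n⇒m%n≡m n<p) ⟩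
    -1ℤ ^ suc m * + unitProd p (suc m)   ≡⟨ cong (λ u → -1ℤ ^ suc m * + u) (unitProd-below (ℕᵖ.<-trans (ℕᵖ.n<1+n m) n<p)) ⟩
    -1ℤ ^ suc m * + (m !)                ≡⟨ ℤᵖ.*-comm (-1ℤ ^ suc m) (+ (m !)) ⟩
    + (m !) * -1ℤ ^ suc m                ∎)
    where open ≡-Reasoning
  ... | inj₂ refl = mod-trans (≡⇒mod (cong (Γnat p) (n%n≡0 p))) (mod-sym (wilson-signed p-prime))

  -- Γ((p+m) mod p) ≡ ⌊(p+m−1)!/p⌋ (−1)^(p+m) for 1 ≤ m ≤ p: the quotient is
  -- (p−1)!(m−1)! and (p−1)!(−1)^p ≡ 1
  Γnat-residue-beyond : ∀ {m} → 0 < m → m ≤ p →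
                        Γnat p ((p + m) % p) ≡ + ((p + m ∸ 1) ! / p) * -1ℤ ^ (p + m) mod p
  Γnat-residue-beyond {suc k} 0<m m≤p = begin
    Γnat p ((p + suc k) % p)                               ≡⟨ cong (Γnat p) (trans (cong (_% p) (ℕᵖ.+-comm p (suc k))) ([m+n]%n≡m%n (suc k) p)) ⟩
    Γnat p (suc k % p)                                     ≈⟨ Γnat-residue 0<m m≤p ⟩
    + (k !) * -1ℤ ^ suc k                                  ≡⟨ ℤᵖ.*-identityˡ _ ⟨
    + 1 * (+ (k !) * -1ℤ ^ suc k)                          ≈⟨ mod-*ʳ _ (mod-sym (wilson-signed p-prime)) ⟩
    (+ ((p ∸ 1) !) * -1ℤ ^ p) * (+ (k !) * -1ℤ ^ suc k)   ≡⟨ regroup (+ ((p ∸ 1) !)) (-1ℤ ^ p) (+ (k !)) (-1ℤ ^ suc k) ⟩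
    (+ ((p ∸ 1) !) * + (k !)) * (-1ℤ ^ p * -1ℤ ^ suc k)   ≈⟨ mod-*ʳ _ (mod-sym (quotient-factorial p k)) ⟩
    + ((p + k) ! / p) * (-1ℤ ^ p * -1ℤ ^ suc k)            ≡⟨ cong₂ (λ t e → + (t ! / p) * e) (cong (_∸ 1) (ℕᵖ.+-suc p k)) (ℤᵖ.^-distribˡ-+-* -1ℤ p (suc k)) ⟨
    + ((p + suc k ∸ 1) ! / p) * -1ℤ ^ (p + suc k)         ∎
    where
    open mod-Reasoning p
    regroup : ∀ a b c d → (a * b) * (c * d) ≡ (a * c) * (b * d)
    regroup = solve-∀

  Γnat-residue-above : ∀ {s} → p < s → s ≤ p + p → Γnat p (s % p) ≡ + ((s ∸ 1) ! / p) * -1ℤ ^ s mod p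
  Γnat-residue-above {s} p<s s≤2p =
    subst (λ t → Γnat p (t % p) ≡ + ((t ∸ 1) ! / p) * -1ℤ ^ t mod p) (ℕᵖ.m+[n∸m]≡n (ℕᵖ.<⇒≤ p<s))
          (Γnat-residue-beyond (ℕᵖ.m<n⇒0<n∸m p<s) s∸p≤p)
    where
    s∸p≤p : s ∸ p ≤ p
    s∸p≤p = ℕᵖ.≤-trans (ℕᵖ.∸-monoˡ-≤ p s≤2p) (ℕᵖ.≤-reflexive (ℕᵖ.m+n∸n≡m p p))

digit₀-fromResidues : ∀ p .{{_ : NonZero p}} f → toℕ (digit (fromResidues p f) 0) ≡ f 1 % p
digit₀-fromResidues p f = trans (toℕ-fromℕ< _) (cong (_% p) (n/1≡n (f 1)))

trunc-one : ∀ {p} (x : ℤₚ p) → trunc x 1 ≡ toℕ (digit x 0)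
trunc-one x = ℕᵖ.*-identityʳ _

rep-residue : ∀ {p} .{{_ : NonZero p}} (x : ℤₚ p) j → (toℕ (digit x 0) + j) % p ≡ (rep x + j) % p
rep-residue {p} x j with toℕ (digit x 0)
... | zero  = sym (trans (cong (_% p) (ℕᵖ.+-comm p j)) ([m+n]%n≡m%n j p))
... | suc r = refl

rep-bounds : ∀ {p} .{{_ : NonZero p}} (x : ℤₚ p) → 0 < rep x × rep x ≤ p
rep-bounds {p} x with toℕ (digit x 0) | toℕ<n (digit x 0)
... | zero  | _   = >-nonZero⁻¹ p , ℕᵖ.≤-refl
... | suc r | r<p = s≤s z≤n , ℕᵖ.<⇒≤ r<p

%-absorbʳ : ∀ {p} .{{_ : NonZero p}} a b → (a + b % p) % p ≡ (a + b) % p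
%-absorbʳ {p} a b = begin
  (a + b % p) % p              ≡⟨ %-distribˡ-+ a (b % p) p ⟩
  (a % p + b % p % p) % p      ≡⟨ cong (λ t → (a % p + t) % p) (m%n%n≡m%n b p) ⟩
  (a % p + b % p) % p          ≡⟨ %-distribˡ-+ a b p ⟨
  (a + b) % p                  ∎
  where open ≡-Reasoning

digit₀-shift : ∀ p .{{_ : NonZero p}} (x : ℤₚ p) j → toℕ (digit (plus p x (ι p j)) 0) ≡ (rep x + j) % p
digit₀-shift p x j = begin
  toℕ (digit (plus p x (ι p j)) 0)       ≡⟨ digit₀-fromResidues p (λ k → trunc x k + trunc (ι p j) k) ⟩
  (trunc x 1 + trunc (ι p j) 1) % p      ≡⟨ cong₂ (λ a b → (a + b) % p) (trunc-one x) (trans (trunc-one (ι p j)) (digit₀-fromResidues p (λ _ → j))) ⟩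
  (toℕ (digit x 0) + j % p) % p          ≡⟨ %-absorbʳ (toℕ (digit x 0)) j ⟩
  (toℕ (digit x 0) + j) % p              ≡⟨ rep-residue x j ⟩
  (rep x + j) % p                        ∎
  where open ≡-Reasoning

Γₚ-digit₀ : ∀ p .{{_ : NonZero p}} y → + toℕ (digit (Γₚ p y) 0) ≡ Γnat p (toℕ (digit y 0)) mod p
Γₚ-digit₀ p y = begin
  + toℕ (digit (Γₚ p y) 0)    ≡⟨ cong +_ (digit₀-fromResidues p (λ k → (Γnat p (trunc y k) %ℕ p ^ℕ k) {{ℕᵖ.m^n≢0 p k}})) ⟩
  + (r % p)                    ≈⟨ mod-sym (remainder (+ r)) ⟩
  + r                          ≈⟨ mod-sym (subst (λ n → z ≡ + r mod n) (ℕᵖ.^-identityʳ p) (remainder {n = p ^ℕ 1} {{ℕᵖ.m^n≢0 p 1}} z)) ⟩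
  z                            ≡⟨ cong (Γnat p) (trunc-one y) ⟩
  Γnat p (toℕ (digit y 0))     ∎
  where
  open mod-Reasoning p
  z : ℤ
  z = Γnat p (trunc y 1)
  r : ℕ
  r = (z %ℕ p ^ℕ 1) {{ℕᵖ.m^n≢0 p 1}}

lemma3p10 : (p : ℕ) (pp : Prime p) → p ≢ 2 → (x : ℤₚ p) (j : ℕ) → j ≤ p →
    ((j ≤ p ∸ rep x →
        (+ p) ∣ ((+ toℕ (digit (Γₚ p {{prime⇒nonZero pp}} (plus p {{prime⇒nonZero pp}} x (ι p {{prime⇒nonZero pp}} j))) 0))
                 - (+ ((rep x + j ∸ 1) !)) * (-[1+ 0 ] ^ (rep x + j))))
    × (j > p ∸ rep x →
        (+ p) ∣ ((+ toℕ (digit (Γₚ p {{prime⇒nonZero pp}} (plus p {{prime⇒nonZero pp}} x (ι p {{prime⇒nonZero pp}} j))) 0))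
                 - (+ (((rep x + j ∸ 1) !) / p) {{prime⇒nonZero pp}}) * (-[1+ 0 ] ^ (rep x + j)))))
lemma3p10 p pp _ x j j≤p =
    (λ j≤p∸r → mod⇒∣ (mod-trans Γ-digit (Γnat-residue pp 0<s (s≤p j≤p∸r))))
  , (λ p∸r<j → mod⇒∣ (mod-trans Γ-digit (Γnat-residue-above pp (p<s p∸r<j) s≤2p)))
  where
  instance
    p≢0 : NonZero p
    p≢0 = prime⇒nonZero pp
  s : ℕ
  s = rep x + j
  Γ-digit : + toℕ (digit (Γₚ p (plus p x (ι p j))) 0) ≡ Γnat p (s % p) mod p
  Γ-digit = subst (λ r → + toℕ (digit (Γₚ p (plus p x (ι p j))) 0) ≡ Γnat p r mod p)
                  (digit₀-shift p x j) (Γₚ-digit₀ p (plus p x (ι p j)))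
  r+[p∸r]≡p : rep x + (p ∸ rep x) ≡ p
  r+[p∸r]≡p = ℕᵖ.m+[n∸m]≡n (proj₂ (rep-bounds x))
  0<s : 0 < s
  0<s = ℕᵖ.<-≤-trans (proj₁ (rep-bounds x)) (ℕᵖ.m≤m+n (rep x) j)
  s≤p : j ≤ p ∸ rep x → s ≤ p
  s≤p j≤p∸r = subst (s ≤_) r+[p∸r]≡p (ℕᵖ.+-monoʳ-≤ (rep x) j≤p∸r)
  p<s : j > p ∸ rep x → p < s
  p<s p∸r<j = subst (_< s) r+[p∸r]≡p (ℕᵖ.+-monoʳ-< (rep x) p∸r<j)
  s≤2p : s ≤ p + p
  s≤2p = ℕᵖ.+-mono-≤ (proj₂ (rep-bounds x)) j≤p
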